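{- As formal power series, \[ \sum_{n\ge 1} \left(\sum_{\sigma\in\mathcal{D}_n} (-1)^{\mathsf{inv}(\sigma)} s^{\mathsf{exc}(\sigma)} t^{\mathsf{depth}(\sigma)}\right)z^n=\sum_{k\ge 1} (-1)^k\left(\sum_{i=0}^{k-1}\binom{k-1}{i} s^{1+i}(1+s)^{k-1-i}z^{k+1+i} \right)t^k. \]
   Context: $\mathcal{D}_n$ is the set of derangements of $[n]=\{1,\dots,n\}$, i.e. permutations $\sigma=\sigma(1)\cdots\sigma(n)$ with $\sigma(i)\ne i$ for all $i$. $\mathsf{inv}(\sigma)$ is the number of pairs $(i,j)$ with $1\le i<j\le n$ and $\sigma(i)>\sigma(j)$. $\mathsf{exc}(\sigma)$ is the number of indices $i$ with $\sigma(i)>i$. $\mathsf{depth}(\sigma)=\sum_{i:\sigma(i)>i}(\sigma(i)-i)$. $s,t,z$ are indeterminates. -}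

module Defs where

open import Level using (Level)
open import Data.Nat using (ℕ; zero; suc; _∸_; _<ᵇ_; _≡ᵇ_) renaming (_+_ to _+ℕ_)
open import Data.Nat.Combinatorics using (_C_)
open import Data.Bool using (Bool; true; false; if_then_else_; _∧_)
open import Data.Fin using (Fin; toℕ)
open import Data.Fin.Properties using (all?) renaming (_≟_ to _≟ᶠ_)
open import Data.Vec using (Vec; []; _∷_; lookup)
open import Data.List using (List; []; _∷_; map; concatMap; filter; foldr; upTo; allFin)
open import Data.Product using (_×_; _,_)
open import Relation.Nullary using (Dec; ¬_)
open import Relation.Nullary.Decidable using (_×-dec_; _→-dec_; ¬?)
open import Relation.Binary.PropositionalEquality using (_≡_)
open import Algebra.Bundles using (CommutativeRing)

-- Permutations / derangements of [n], encoded with 0-based indices: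
-- σ : Vec (Fin n) n, σ(i) = lookup σ i.  (Shifting all values and
-- positions by one does not change inv, exc, depth.)

allVecs : (n m : ℕ) → List (Vec (Fin n) m)
allVecs n zero    = [] ∷ []
allVecs n (suc m) = concatMap (λ x → map (x ∷_) (allVecs n m)) (allFin n)

IsDerangement : {n : ℕ} → Vec (Fin n) n → Set
IsDerangement {n} σ =
  (∀ i j → lookup σ i ≡ lookup σ j → i ≡ j) × (∀ i → ¬ (lookup σ i ≡ i))

isDerangement? : {n : ℕ} (σ : Vec (Fin n) n) → Dec (IsDerangement σ)
isDerangement? σ =
  all? (λ i → all? (λ j → (lookup σ i ≟ᶠ lookup σ j) →-dec (i ≟ᶠ j)))
  ×-dec all? (λ i → ¬? (lookup σ i ≟ᶠ i))

derangements : (n : ℕ) → List (Vec (Fin n) n)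
derangements n = filter isDerangement? (allVecs n n)

sumℕ : List ℕ → ℕ
sumℕ = foldr _+ℕ_ 0

inv : {n : ℕ} → Vec (Fin n) n → ℕ
inv {n} σ = sumℕ (concatMap (λ i → map (λ j →
  if (toℕ i <ᵇ toℕ j) ∧ (toℕ (lookup σ j) <ᵇ toℕ (lookup σ i)) then 1 else 0)
  (allFin n)) (allFin n))

exc : {n : ℕ} → Vec (Fin n) n → ℕ
exc {n} σ = sumℕ (map (λ i → if toℕ i <ᵇ toℕ (lookup σ i) then 1 else 0) (allFin n))

depth : {n : ℕ} → Vec (Fin n) n → ℕ
depth {n} σ = sumℕ (map (λ i →
  if toℕ i <ᵇ toℕ (lookup σ i) then toℕ (lookup σ i) ∸ toℕ i else 0) (allFin n))

module _ {c ℓ : Level} (R : CommutativeRing c ℓ) where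
  open CommutativeRing R

  sumR : List Carrier → Carrier
  sumR = foldr _+_ 0#

  pow : Carrier → ℕ → Carrier
  pow x zero    = 1#
  pow x (suc k) = x * pow x k

  fromℕ : ℕ → Carrier
  fromℕ zero    = 0#
  fromℕ (suc k) = 1# + fromℕ k

  -- coefficient of z^n on the left-hand side:
  -- Σ_{σ ∈ 𝒟ₙ} (-1)^inv(σ) s^exc(σ) t^depth(σ)
  lhsCoeff : ℕ → Carrier → Carrier → Carrier
  lhsCoeff n s t = sumR (map (λ σ →
    pow (- 1#) (inv σ) * pow s (exc σ) * pow t (depth σ)) (derangements n))

  -- coefficient of z^n on the right-hand side:
  -- Σ_{k ≥ 1} Σ_{i=0}^{k-1} [k+1+i = n] (-1)^k C(k-1,i) s^(1+i) (1+s)^(k-1-i) t^k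
  -- (only k ≤ n can contribute, so k ranges over 1..n)
  rhsCoeff : ℕ → Carrier → Carrier → Carrier
  rhsCoeff n s t = sumR (concatMap (λ k → map (λ i →
    if (k +ℕ 1 +ℕ i) ≡ᵇ n
    then pow (- 1#) k * fromℕ ((k ∸ 1) C i) * pow s (1 +ℕ i)
           * pow (1# + s) (k ∸ 1 ∸ i) * pow t k
    else 0#) (upTo k)) (map suc (upTo n)))

-- The coefficient of zⁿ on the left is the determinant Dₙ of the n × n matrix Mₙ with zero
-- diagonal, entries 1 below the diagonal and s·t^(j−i) above it: in the Leibniz expansion a
-- derangement σ contributes (−1)^inv(σ) s^exc(σ) t^depth(σ), and every other permutation meets
-- the zero diagonal.  Row 0 of Mₙ₊₂ minus t times row 1 is (−t, st, 0, …, 0), so expanding along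
-- it gives Dₙ₊₂ = −t(1+s) Dₙ₊₁ − st Dₙ with D₀ = 1, D₁ = 0.  On the right, the coefficient of
-- z^(m+2) is the antidiagonal sum of the summands indexed by j + i = m (with k = j + 1), and
-- Pascal's rule makes these antidiagonal sums obey the same recurrence with the same start.
module Submission where

open import Defs
open import Level using (Level)
open import Data.Nat using (ℕ; zero; suc; _≤_)
open import Algebra.Bundles using (CommutativeRing; Semiring)
open import Function using (const)
import Relation.Binary.Reasoning.Setoid

module IntegerCoefficientSolver {c ℓ : Level} (R : CommutativeRing c ℓ) where
  open CommutativeRing R
  open import Algebra.Properties.Ring ring using (-0#≈0#; -‿involutive; -1*x≈-x)
  open import Algebra.Properties.AbelianGroup +-abelianGroup using (xyx⁻¹≈y; ⁻¹-∙-comm)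
  open import Algebra.Properties.Group +-group using (⁻¹-anti-homo-∙)
  open import Algebra.Properties.CommutativeSemigroup *-commutativeSemigroup using (interchange)
  open import Algebra.Properties.Semiring.Mult.TCOptimised semiring using (_×_; ×-homo-+; ×1-homo-*)
  open import Algebra.Solver.Ring.AlmostCommutativeRing
    using (fromCommutativeRing; _-Raw-AlmostCommutative⟶_)
  open import Data.Nat as ℕ using ()
  import Data.Nat.Properties as ℕ
  open import Data.Integer as ℤ using (ℤ; +_; -[1+_]; _⊖_; _◃_; sign; ∣_∣)
  import Data.Integer.Properties as ℤ
  open import Data.Sign as Sign using (Sign)
  open import Data.Maybe using (Maybe; just; nothing)
  open import Relation.Nullary using (yes; no)
  open import Relation.Binary.PropositionalEquality as ≡ using (_≡_)
  open Relation.Binary.Reasoning.Setoid setoid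

  -- The optimised _×_ has 0 × x = 0# and 1 × x = x definitionally, so the solver's constants
  -- con (+ 0) and con (+ 1) evaluate to 0# and 1# themselves.
  fromℤ : ℤ → Carrier
  fromℤ (+ n)      = n × 1#
  fromℤ (-[1+ n ]) = - (suc n × 1#)

  fromSign : Sign → Carrier
  fromSign Sign.+ = 1#
  fromSign Sign.- = - 1#

  ⊖-homo : ∀ m n → fromℤ (m ⊖ n) ≈ m × 1# - n × 1#
  ⊖-homo zero    zero    = sym (trans (+-congˡ -0#≈0#) (+-identityʳ _))
  ⊖-homo zero    (suc n) = sym (+-identityˡ _)
  ⊖-homo (suc m) zero    = sym (trans (+-congˡ -0#≈0#) (+-identityʳ _))
  ⊖-homo (suc m) (suc n) = begin
    fromℤ (suc m ⊖ suc n)              ≡⟨ ≡.cong fromℤ (ℤ.[1+m]⊖[1+n]≡m⊖n m n) ⟩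
    fromℤ (m ⊖ n)                      ≈⟨ ⊖-homo m n ⟩
    m × 1# - n × 1#                    ≈⟨ xyx⁻¹≈y 1# _ ⟨
    1# + (m × 1# - n × 1#) - 1#        ≈⟨ +-congʳ (+-assoc _ _ _) ⟨
    1# + m × 1# - n × 1# - 1#          ≈⟨ +-assoc _ _ _ ⟩
    (1# + m × 1#) + (- (n × 1#) - 1#)  ≈⟨ +-congˡ (⁻¹-anti-homo-∙ 1# _) ⟨
    (1# + m × 1#) - (1# + n × 1#)      ≈⟨ +-cong (×-homo-+ 1# 1 m) (-‿cong (×-homo-+ 1# 1 n)) ⟨
    suc m × 1# - suc n × 1#            ∎

  +-homo : ∀ i j → fromℤ (i ℤ.+ j) ≈ fromℤ i + fromℤ j
  +-homo (+ m)    (+ n)    = ×-homo-+ 1# m n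
  +-homo (+ m)    -[1+ n ] = ⊖-homo m (suc n)
  +-homo -[1+ m ] (+ n)    = trans (⊖-homo n (suc m)) (+-comm _ _)
  +-homo -[1+ m ] -[1+ n ] = begin
    - (suc (suc (m ℕ.+ n)) × 1#)  ≡⟨ ≡.cong (λ k → - (suc k × 1#)) (ℕ.+-suc m n) ⟨
    - ((suc m ℕ.+ suc n) × 1#)    ≈⟨ -‿cong (×-homo-+ 1# (suc m) (suc n)) ⟩
    - (suc m × 1# + suc n × 1#)          ≈⟨ ⁻¹-∙-comm _ _ ⟨
    - (suc m × 1#) - suc n × 1#          ∎

  ◃-homo : ∀ s n → fromℤ (s ◃ n) ≈ fromSign s * n × 1#
  ◃-homo s      zero    = sym (zeroʳ _)
  ◃-homo Sign.+ (suc n) = sym (*-identityˡ _)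
  ◃-homo Sign.- (suc n) = sym (-1*x≈-x _)

  fromSign-homo : ∀ s s′ → fromSign (s Sign.* s′) ≈ fromSign s * fromSign s′
  fromSign-homo Sign.+ s′     = sym (*-identityˡ _)
  fromSign-homo Sign.- Sign.+ = sym (*-identityʳ _)
  fromSign-homo Sign.- Sign.- = sym (trans (-1*x≈-x _) (-‿involutive _))

  fromℤ-signAbs : ∀ i → fromℤ i ≈ fromSign (sign i) * ∣ i ∣ × 1#
  fromℤ-signAbs i = trans (reflexive (≡.cong fromℤ (≡.sym (ℤ.◃-inverse i)))) (◃-homo (sign i) ∣ i ∣)

  *-homo : ∀ i j → fromℤ (i ℤ.* j) ≈ fromℤ i * fromℤ j
  *-homo i j = begin
    fromℤ (sign i Sign.* sign j ◃ ∣ i ∣ ℕ.* ∣ j ∣)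
      ≈⟨ ◃-homo (sign i Sign.* sign j) (∣ i ∣ ℕ.* ∣ j ∣) ⟩
    fromSign (sign i Sign.* sign j) * (∣ i ∣ ℕ.* ∣ j ∣) × 1#
      ≈⟨ *-cong (fromSign-homo (sign i) (sign j)) (×1-homo-* ∣ i ∣ ∣ j ∣) ⟩
    (fromSign (sign i) * fromSign (sign j)) * (∣ i ∣ × 1# * ∣ j ∣ × 1#)
      ≈⟨ interchange _ _ _ _ ⟩
    (fromSign (sign i) * ∣ i ∣ × 1#) * (fromSign (sign j) * ∣ j ∣ × 1#)
      ≈⟨ *-cong (fromℤ-signAbs i) (fromℤ-signAbs j) ⟨
    fromℤ i * fromℤ j ∎

  -‿homo : ∀ i → fromℤ (ℤ.- i) ≈ - fromℤ i
  -‿homo -[1+ n ]  = sym (-‿involutive _)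
  -‿homo (+ zero)  = sym -0#≈0#
  -‿homo (+ suc n) = refl

  fromℤ-homomorphism : CommutativeRing.rawRing ℤ.+-*-commutativeRing -Raw-AlmostCommutative⟶ fromCommutativeRing R
  fromℤ-homomorphism = record
    { ⟦_⟧ = fromℤ ; +-homo = +-homo ; *-homo = *-homo ; -‿homo = -‿homo ; 0-homo = refl ; 1-homo = refl }

  fromℤ-≟ : ∀ i j → Maybe (fromℤ i ≈ fromℤ j)
  fromℤ-≟ i j with i ℤ.≟ j
  ... | yes ≡.refl = just refl
  ... | no _       = nothing

  open import Algebra.Solver.Ring _ _ fromℤ-homomorphism fromℤ-≟ public

module ListSum {c ℓ : Level} (S : Semiring c ℓ) where
  open Semiring S
  open import Algebra.Properties.Semiring.Sum S using (sum)
  open import Data.Fin using (Fin; toℕ)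
  open import Data.List using (List; []; _∷_; _++_; foldr; map; concatMap; filter; tabulate; applyUpTo)
  open import Relation.Nullary using (¬_; yes; no)
  open import Relation.Unary using (Decidable)
  open import Relation.Binary.PropositionalEquality as ≡ using (_≡_)

  sumₗ : List Carrier → Carrier
  sumₗ = foldr _+_ 0#

  sumₗ-++ : ∀ xs ys → sumₗ (xs ++ ys) ≈ sumₗ xs + sumₗ ys
  sumₗ-++ []       ys = sym (+-identityˡ _)
  sumₗ-++ (x ∷ xs) ys = trans (+-congˡ (sumₗ-++ xs ys)) (sym (+-assoc _ _ _))

  sumₗ-concatMap : ∀ {a} {A : Set a} (g : A → List Carrier) xs →
                   sumₗ (concatMap g xs) ≈ sumₗ (map (λ x → sumₗ (g x)) xs)
  sumₗ-concatMap g []       = refl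
  sumₗ-concatMap g (x ∷ xs) = trans (sumₗ-++ (g x) _) (+-congˡ (sumₗ-concatMap g xs))

  sumₗ-map-cong : ∀ {a} {A : Set a} {f g : A → Carrier} → (∀ x → f x ≈ g x) → ∀ xs →
                  sumₗ (map f xs) ≈ sumₗ (map g xs)
  sumₗ-map-cong f≈g []       = refl
  sumₗ-map-cong f≈g (x ∷ xs) = +-cong (f≈g x) (sumₗ-map-cong f≈g xs)

  *-distribˡ-sumₗ : ∀ {a} {A : Set a} y (f : A → Carrier) xs → sumₗ (map (λ x → y * f x) xs) ≈ y * sumₗ (map f xs)
  *-distribˡ-sumₗ y f []       = sym (zeroʳ y)
  *-distribˡ-sumₗ y f (x ∷ xs) = trans (+-congˡ (*-distribˡ-sumₗ y f xs)) (sym (distribˡ _ _ _))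

  sumₗ-map-filter : ∀ {a p} {A : Set a} {P : A → Set p} (P? : Decidable P) {f g : A → Carrier} →
                    (∀ x → P x → f x ≈ g x) → (∀ x → ¬ P x → g x ≈ 0#) → ∀ xs →
                    sumₗ (map f (filter P? xs)) ≈ sumₗ (map g xs)
  sumₗ-map-filter P? f≈g g≈0 []       = refl
  sumₗ-map-filter P? f≈g g≈0 (x ∷ xs) with P? x
  ... | yes px = +-cong (f≈g x px) (sumₗ-map-filter P? f≈g g≈0 xs)
  ... | no ¬px = trans (sumₗ-map-filter P? f≈g g≈0 xs) (sym (trans (+-congʳ (g≈0 x ¬px)) (+-identityˡ _)))

  sumₗ-map-tabulate : ∀ {n a} {A : Set a} (f : A → Carrier) (g : Fin n → A) →
                      sumₗ (map f (tabulate g)) ≡ sum {n} (λ i → f (g i))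
  sumₗ-map-tabulate {zero}  f g = ≡.refl
  sumₗ-map-tabulate {suc n} f g = ≡.cong (f (g _) +_) (sumₗ-map-tabulate f (λ i → g (Fin.suc i)))

  sumₗ-map-applyUpTo : ∀ {a} {A : Set a} (f : A → Carrier) (g : ℕ → A) n →
                       sumₗ (map f (applyUpTo g n)) ≡ sum {n} (λ i → f (g (toℕ i)))
  sumₗ-map-applyUpTo f g zero    = ≡.refl
  sumₗ-map-applyUpTo f g (suc n) = ≡.cong (f (g 0) +_) (sumₗ-map-applyUpTo f (λ k → g (suc k)) n)

module Determinant {c ℓ : Level} (R : CommutativeRing c ℓ) where
  open CommutativeRing R hiding (zero)
  open IntegerCoefficientSolver R using (solve; _:=_; _:+_; _:*_; :-_; con)
  open import Algebra.Properties.Ring ring using (-‿involutive; -0#≈0#)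
  open import Algebra.Properties.Semiring.Sum semiring
    using (sum; sum-syntax; sum-cong-≋; sum-remove; sum-replicate-zero; ∑-distrib-+; *-distribˡ-sum)
  open import Data.Integer using (+_)
  open import Data.Fin using (Fin; zero; suc; punchIn)
  open import Data.Vec.Functional using (Vector; _∷_; tail; removeAt)
  open import Function using (_∘_)
  open import Relation.Binary.PropositionalEquality as ≡ using (_≡_)
  open Relation.Binary.Reasoning.Setoid setoid

  sgn : ∀ {n} → Fin n → Fin n → Carrier
  sgn zero    zero    = 0#
  sgn zero    (suc _) = 1#
  sgn (suc _) zero    = - 1#
  sgn (suc x) (suc y) = sgn x y

  sgn-diag : ∀ {n} {x y : Fin n} → x ≡ y → sgn x y ≈ 0#
  sgn-diag {x = zero}  ≡.refl = refl
  sgn-diag {x = suc x} ≡.refl = sgn-diag {x = x} ≡.refl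

  sgn-antisym : ∀ {n} (x y : Fin n) → sgn x y ≈ - sgn y x
  sgn-antisym zero    zero    = sym -0#≈0#
  sgn-antisym zero    (suc y) = sym (-‿involutive 1#)
  sgn-antisym (suc x) zero    = refl
  sgn-antisym (suc x) (suc y) = sgn-antisym x y

  sgn-punchIn : ∀ {n} (k : Fin (suc n)) (x y : Fin n) → sgn (punchIn k x) (punchIn k y) ≡ sgn x y
  sgn-punchIn zero    x       y       = ≡.refl
  sgn-punchIn (suc k) zero    zero    = ≡.refl
  sgn-punchIn (suc k) zero    (suc y) = ≡.refl
  sgn-punchIn (suc k) (suc x) zero    = ≡.refl
  sgn-punchIn (suc k) (suc x) (suc y) = sgn-punchIn k x y

  -- Column y carries the weight ψ y, which accumulates the signs sgn x y of the rows already
  -- expanded, so det ψ A is the sum over all words x ∈ (Fin n)^m of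
  -- Πᵢ ψ xᵢ · Π_{i<j} sgn xᵢ xⱼ · Πᵢ A i xᵢ (det-leibniz); words with a repeated letter vanish,
  -- and for m = n, ψ = const 1# this is the determinant of A.
  det : ∀ {m n} → Vector Carrier n → Vector (Vector Carrier n) m → Carrier
  det {zero}      ψ A = 1#
  det {suc m} {n} ψ A = ∑[ x < n ] (ψ x * A zero x * det (λ y → ψ y * sgn x y) (tail A))

  det-cong : ∀ {m n} {ψ ψ′ : Vector Carrier n} {A A′ : Vector (Vector Carrier n) m} →
             (∀ y → ψ y ≈ ψ′ y) → (∀ i y → A i y ≈ A′ i y) → det ψ A ≈ det ψ′ A′
  det-cong {zero}  ψ≈ψ′ A≈A′ = refl
  det-cong {suc m} ψ≈ψ′ A≈A′ = sum-cong-≋ λ x →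
    *-cong (*-cong (ψ≈ψ′ x) (A≈A′ zero x)) (det-cong (λ y → *-congʳ (ψ≈ψ′ y)) (A≈A′ ∘ suc))

  sum-zero : ∀ {n} {f : Vector Carrier n} → (∀ i → f i ≈ 0#) → sum f ≈ 0#
  sum-zero {n} f≈0 = trans (sum-cong-≋ f≈0) (sum-replicate-zero n)

  det-linear : ∀ {m n} (ψ : Vector Carrier n) (B : Vector (Vector Carrier n) m) (a : Carrier) {r u w : Vector Carrier n} →
               (∀ x → r x ≈ a * u x + w x) → det ψ (r ∷ B) ≈ a * det ψ (u ∷ B) + det ψ (w ∷ B)
  det-linear {n = n} ψ B a {r} {u} {w} r≈au+w = begin
    ∑[ x < n ] (ψ x * r x * X x)
      ≈⟨ sum-cong-≋ (λ x → expand (r≈au+w x)) ⟩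
    ∑[ x < n ] (a * (ψ x * u x * X x) + ψ x * w x * X x)
      ≈⟨ ∑-distrib-+ (λ x → a * (ψ x * u x * X x)) (λ x → ψ x * w x * X x) ⟩
    ∑[ x < n ] (a * (ψ x * u x * X x)) + det ψ (w ∷ B)
      ≈⟨ +-congʳ (*-distribˡ-sum a (λ x → ψ x * u x * X x)) ⟨
    a * det ψ (u ∷ B) + det ψ (w ∷ B) ∎
    where
    X : Vector Carrier n
    X x = det (λ y → ψ y * sgn x y) B
    expand : ∀ {p q v y z} → q ≈ a * v + y → p * q * z ≈ a * (p * v * z) + p * y * z
    expand {p} {q} {v} {y} {z} q≈av+y = trans (*-congʳ (*-congˡ q≈av+y))
      (solve 5 (λ a p v y z → p :* (a :* v :+ y) :* z := a :* (p :* v :* z) :+ p :* y :* z) refl a p v y z)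

  ∑∑-antisym : ∀ {n} (h : Fin n → Fin n → Carrier) → (∀ x → h x x ≈ 0#) → (∀ x y → h x y ≈ - h y x) →
               ∑[ x < n ] ∑[ y < n ] h x y ≈ 0#
  ∑∑-antisym {zero}  h h-diag h-anti = refl
  ∑∑-antisym {suc n} h h-diag h-anti = begin
    (h zero zero + ∑[ y < n ] h zero (suc y)) + ∑[ x < n ] (h (suc x) zero + ∑[ y < n ] h (suc x) (suc y))
      ≈⟨ +-cong (+-congʳ (h-diag zero)) (∑-distrib-+ (λ x → h (suc x) zero) _) ⟩
    (0# + ∑[ y < n ] h zero (suc y)) + (∑[ x < n ] h (suc x) zero + ∑[ x < n ] ∑[ y < n ] h (suc x) (suc y))
      ≈⟨ +-cong (+-identityˡ _)
                (+-congˡ (∑∑-antisym (λ x y → h (suc x) (suc y)) (h-diag ∘ suc) (λ x y → h-anti (suc x) (suc y)))) ⟩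
    ∑[ y < n ] h zero (suc y) + (∑[ x < n ] h (suc x) zero + 0#)
      ≈⟨ +-congˡ (+-identityʳ _) ⟩
    ∑[ y < n ] h zero (suc y) + ∑[ x < n ] h (suc x) zero
      ≈⟨ ∑-distrib-+ (λ y → h zero (suc y)) (λ x → h (suc x) zero) ⟨
    ∑[ y < n ] (h zero (suc y) + h (suc y) zero)
      ≈⟨ sum-zero (λ y → trans (+-congˡ (h-anti (suc y) zero)) (-‿inverseʳ _)) ⟩
    0# ∎

  det-repeatedRow : ∀ {m n} (ψ r : Vector Carrier n) (B : Vector (Vector Carrier n) m) → det ψ (r ∷ r ∷ B) ≈ 0#
  det-repeatedRow {n = n} ψ r B = begin
    ∑[ x < n ] (ψ x * r x * ∑[ y < n ] (ψ y * sgn x y * r y * X x y))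
      ≈⟨ sum-cong-≋ (λ x → *-distribˡ-sum (ψ x * r x) (λ y → ψ y * sgn x y * r y * X x y)) ⟩
    ∑[ x < n ] ∑[ y < n ] h x y
      ≈⟨ ∑∑-antisym h h-diag h-anti ⟩
    0# ∎
    where
    X : Fin n → Fin n → Carrier
    X x y = det (λ z → ψ z * sgn x z * sgn y z) B
    h : Fin n → Fin n → Carrier
    h x y = ψ x * r x * (ψ y * sgn x y * r y * X x y)
    h-diag : ∀ x → h x x ≈ 0#
    h-diag x = trans (*-congˡ (*-congʳ (*-congʳ (*-congˡ (sgn-diag {x = x} ≡.refl)))))
      (solve 4 (λ a b c d → a :* b :* (c :* con (+ 0) :* b :* d) := con (+ 0)) refl (ψ x) (r x) (ψ x) (X x x))
    X-sym : ∀ x y → X x y ≈ X y x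
    X-sym x y = det-cong {A = B} (λ z → solve 3 (λ a b c → a :* b :* c := a :* c :* b) refl (ψ z) (sgn x z) (sgn y z))
                                 (λ _ _ → refl)
    h-anti : ∀ x y → h x y ≈ - h y x
    h-anti x y = begin
      ψ x * r x * (ψ y * sgn x y * r y * X x y)
        ≈⟨ *-congˡ (*-cong (*-congʳ (*-congˡ (sgn-antisym x y))) (X-sym x y)) ⟩
      ψ x * r x * (ψ y * - sgn y x * r y * X y x)
        ≈⟨ solve 6 (λ a b c d e f → a :* b :* (c :* (:- e) :* d :* f) := :- (c :* d :* (a :* e :* b :* f)))
                   refl (ψ x) (r x) (ψ y) (r y) (sgn y x) (X y x) ⟩
      - h y x ∎

  det-removeColumn : ∀ {m n} (k : Fin (suc n)) (ψ : Vector Carrier (suc n)) (A : Vector (Vector Carrier (suc n)) m) →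
                     ψ k ≈ 0# → det ψ A ≈ det (removeAt ψ k) (λ i → removeAt (A i) k)
  det-removeColumn {zero}      k ψ A ψk≈0 = refl
  det-removeColumn {suc m} {n} k ψ A ψk≈0 = begin
    ∑[ x < suc n ] f x                                ≈⟨ sum-remove {i = k} f ⟩
    f k + ∑[ x < n ] f (punchIn k x)                  ≈⟨ +-cong (trans (*-congʳ (trans (*-congʳ ψk≈0) (zeroˡ _))) (zeroˡ _))
                                                                (sum-cong-≋ λ x → *-congˡ (minor x)) ⟩
    0# + det (removeAt ψ k) (λ i → removeAt (A i) k)  ≈⟨ +-identityˡ _ ⟩
    det (removeAt ψ k) (λ i → removeAt (A i) k)       ∎
    where
    f : Vector Carrier (suc n)
    f x = ψ x * A zero x * det (λ y → ψ y * sgn x y) (tail A)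
    minor : ∀ x → det (λ y → ψ y * sgn (punchIn k x) y) (tail A)
                ≈ det (λ y → ψ (punchIn k y) * sgn x y) (λ i → removeAt (A (suc i)) k)
    minor x = trans (det-removeColumn k _ (tail A) (trans (*-congʳ ψk≈0) (zeroˡ _)))
                    (det-cong {A = λ i → removeAt (A (suc i)) k} (λ y → *-congˡ (reflexive (sgn-punchIn k x y)))
                              (λ _ _ → refl))

module Leibniz {c ℓ : Level} (R : CommutativeRing c ℓ) where
  open CommutativeRing R hiding (zero)
  open IntegerCoefficientSolver R using (solve; _:=_; _:*_)
  open Determinant R
  open ListSum semiring using (sumₗ; sumₗ-concatMap; sumₗ-map-cong; *-distribˡ-sumₗ; sumₗ-map-tabulate)
  open import Algebra.Properties.Semiring.Sum semiring using (sum-syntax; sum-cong-≋)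
  open import Algebra.Properties.CommutativeMonoid.Sum *-commutativeMonoid
    using () renaming (sum to ∏; sum-cong-≋ to ∏-cong; ∑-distrib-+ to ∏-distrib-*)
  open import Data.Nat as ℕ using (_<ᵇ_)
  import Data.Nat.Properties as ℕ
  import Algebra.Properties.Semiring.Sum ℕ.+-*-semiring as ℕΣ
  open import Data.Bool using (if_then_else_; _∧_)
  open import Data.Empty using (⊥-elim)
  open import Data.Fin using (Fin; zero; suc; toℕ)
  open import Data.Fin.Properties using (suc-injective; 0≢1+n)
  open import Data.Vec using (Vec; []; _∷_; lookup)
  open import Data.Vec.Functional using (Vector; tail)
  open import Data.List using (List; map; concatMap; allFin)
  open import Data.List.Properties using (map-concatMap; map-∘)
  open import Function using (_∘_)
  open import Relation.Binary.PropositionalEquality as ≡ using (_≡_; _≢_)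
  open Relation.Binary.Reasoning.Setoid setoid

  module ℕList = ListSum ℕ.+-*-semiring

  signature : ∀ {m n} → Vec (Fin n) m → Carrier
  signature []      = 1#
  signature (x ∷ v) = ∏ (λ j → sgn x (lookup v j)) * signature v

  leibnizTerm : ∀ {m n} → Vector Carrier n → Vector (Vector Carrier n) m → Vec (Fin n) m → Carrier
  leibnizTerm ψ A v = ∏ (λ i → ψ (lookup v i)) * signature v * ∏ (λ i → A i (lookup v i))

  leibnizTerm-∷ : ∀ {m n} (ψ : Vector Carrier n) (A : Vector (Vector Carrier n) (suc m)) x v →
                  leibnizTerm ψ A (x ∷ v) ≈ ψ x * A zero x * leibnizTerm (λ y → ψ y * sgn x y) (tail A) v
  leibnizTerm-∷ ψ A x v = begin
    ψ x * W * (S * σ) * (A zero x * P)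
      ≈⟨ solve 6 (λ ψx W S σ a P → ψx :* W :* (S :* σ) :* (a :* P) := ψx :* a :* (W :* S :* σ :* P))
                 refl (ψ x) W S σ (A zero x) P ⟩
    ψ x * A zero x * (W * S * σ * P)
      ≈⟨ *-congˡ (*-congʳ (*-congʳ (∏-distrib-* (λ i → ψ (lookup v i)) (λ i → sgn x (lookup v i))))) ⟨
    ψ x * A zero x * leibnizTerm (λ y → ψ y * sgn x y) (tail A) v ∎
    where
    W S σ P : Carrier
    W = ∏ (λ i → ψ (lookup v i))
    S = ∏ (λ j → sgn x (lookup v j))
    σ = signature v
    P = ∏ (λ i → A (suc i) (lookup v i))

  det-leibniz : ∀ {m n} (ψ : Vector Carrier n) (A : Vector (Vector Carrier n) m) →
                det ψ A ≈ sumₗ (map (leibnizTerm ψ A) (allVecs n m))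
  det-leibniz {zero}      ψ A = sym (trans (+-identityʳ _) (trans (*-identityʳ _) (*-identityʳ _)))
  det-leibniz {suc m} {n} ψ A = sym (begin
    sumₗ (map (leibnizTerm ψ A) (concatMap (λ x → map (x ∷_) (allVecs n m)) (allFin n)))
      ≡⟨ ≡.cong sumₗ (map-concatMap (leibnizTerm ψ A) _ (allFin n)) ⟩
    sumₗ (concatMap row (allFin n))
      ≈⟨ sumₗ-concatMap row (allFin n) ⟩
    sumₗ (map (λ x → sumₗ (row x)) (allFin n))
      ≡⟨ sumₗ-map-tabulate (λ x → sumₗ (row x)) (λ x → x) ⟩
    ∑[ x < n ] sumₗ (row x)
      ≈⟨ sum-cong-≋ expand-row ⟩
    det ψ A ∎)
    where
    row : Fin n → List Carrier
    row x = map (leibnizTerm ψ A) (map (x ∷_) (allVecs n m))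
    expand-row : ∀ x → sumₗ (row x) ≈ ψ x * A zero x * det (λ y → ψ y * sgn x y) (tail A)
    expand-row x = begin
      sumₗ (row x)
        ≡⟨ ≡.cong sumₗ (map-∘ (allVecs n m)) ⟨
      sumₗ (map (λ v → leibnizTerm ψ A (x ∷ v)) (allVecs n m))
        ≈⟨ sumₗ-map-cong (leibnizTerm-∷ ψ A x) (allVecs n m) ⟩
      sumₗ (map (λ v → ψ x * A zero x * leibnizTerm ψ′ (tail A) v) (allVecs n m))
        ≈⟨ *-distribˡ-sumₗ _ _ (allVecs n m) ⟩
      ψ x * A zero x * sumₗ (map (leibnizTerm ψ′ (tail A)) (allVecs n m))
        ≈⟨ *-congˡ (det-leibniz ψ′ (tail A)) ⟨
      ψ x * A zero x * det ψ′ (tail A) ∎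
      where
      ψ′ : Vector Carrier n
      ψ′ y = ψ y * sgn x y

  inversions : ∀ {m n} → Vec (Fin n) m → ℕ
  inversions {m} v = ℕΣ.sum {m} (λ i → ℕΣ.sum {m} (λ j →
    if (toℕ i <ᵇ toℕ j) ∧ (toℕ (lookup v j) <ᵇ toℕ (lookup v i)) then 1 else 0))

  inv≡inversions : ∀ {n} (σ : Vec (Fin n) n) → inv σ ≡ inversions σ
  inv≡inversions {n} σ = ≡.trans (ℕList.sumₗ-concatMap (λ i → map (b i) (allFin n)) (allFin n))
    (≡.trans (ℕList.sumₗ-map-tabulate (λ i → ℕList.sumₗ (map (b i) (allFin n))) (λ i → i))
             (ℕΣ.sum-cong-≗ (λ i → ℕList.sumₗ-map-tabulate (b i) (λ j → j))))
    where
    b : Fin n → Fin n → ℕ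
    b i j = if (toℕ i <ᵇ toℕ j) ∧ (toℕ (lookup σ j) <ᵇ toℕ (lookup σ i)) then 1 else 0

  pow-+ : ∀ x a b → pow R x (a ℕ.+ b) ≈ pow R x a * pow R x b
  pow-+ x zero    b = sym (*-identityˡ _)
  pow-+ x (suc a) b = trans (*-congˡ (pow-+ x a b)) (sym (*-assoc _ _ _))

  ∏-pow : ∀ {m} x (e : Fin m → ℕ) → ∏ (λ i → pow R x (e i)) ≈ pow R x (ℕΣ.sum e)
  ∏-pow {zero}  x e = refl
  ∏-pow {suc m} x e = trans (*-congˡ (∏-pow x (e ∘ suc))) (sym (pow-+ x (e zero) _))

  ∏-zero : ∀ {m} (f : Vector Carrier m) j → f j ≈ 0# → ∏ f ≈ 0#
  ∏-zero f zero    fj≈0 = trans (*-congʳ fj≈0) (zeroˡ _)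
  ∏-zero f (suc j) fj≈0 = trans (*-congˡ (∏-zero (f ∘ suc) j fj≈0)) (zeroʳ _)

  sgn≈pow : ∀ {n} (x y : Fin n) → y ≢ x → sgn x y ≈ pow R (- 1#) (if toℕ y <ᵇ toℕ x then 1 else 0)
  sgn≈pow zero    zero    y≢x = ⊥-elim (y≢x ≡.refl)
  sgn≈pow zero    (suc y) y≢x = refl
  sgn≈pow (suc x) zero    y≢x = sym (*-identityʳ _)
  sgn≈pow (suc x) (suc y) y≢x = sgn≈pow x y (y≢x ∘ ≡.cong suc)

  signature-injective : ∀ {m n} (v : Vec (Fin n) m) → (∀ i j → lookup v i ≡ lookup v j → i ≡ j) →
                        signature v ≈ pow R (- 1#) (inversions v)
  signature-injective []      injective = refl
  signature-injective (x ∷ v) injective = begin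
    ∏ (λ j → sgn x (lookup v j)) * signature v
      ≈⟨ *-cong (trans (∏-cong (λ j → sgn≈pow x (lookup v j) (x∉v j))) (∏-pow (- 1#) below))
                (signature-injective v (λ i j eq → suc-injective (injective (suc i) (suc j) eq))) ⟩
    pow R (- 1#) (ℕΣ.sum below) * pow R (- 1#) (inversions v)
      -- inversions (x ∷ v) reduces to ℕΣ.sum below + inversions v
      ≈⟨ pow-+ (- 1#) (ℕΣ.sum below) (inversions v) ⟨
    pow R (- 1#) (inversions (x ∷ v)) ∎
    where
    below : Fin _ → ℕ
    below j = if toℕ (lookup v j) <ᵇ toℕ x then 1 else 0
    x∉v : ∀ j → lookup v j ≢ x
    x∉v j eq = 0≢1+n (injective zero (suc j) (≡.sym eq))

  signature-collision : ∀ {m n} (v : Vec (Fin n) m) i j → i ≢ j → lookup v i ≡ lookup v j → signature v ≈ 0#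
  signature-collision (x ∷ v) zero    zero    i≢j _  = ⊥-elim (i≢j ≡.refl)
  signature-collision (x ∷ v) zero    (suc j) _   eq = trans (*-congʳ (∏-zero _ j (sgn-diag eq))) (zeroˡ _)
  signature-collision (x ∷ v) (suc i) zero    _   eq = trans (*-congʳ (∏-zero _ i (sgn-diag (≡.sym eq)))) (zeroˡ _)
  signature-collision (x ∷ v) (suc i) (suc j) i≢j eq =
    trans (*-congˡ (signature-collision v i j (i≢j ∘ ≡.cong suc) eq)) (zeroʳ _)

module SecondOrderRecurrence {c ℓ : Level} (R : CommutativeRing c ℓ) (α β : CommutativeRing.Carrier R) where
  open CommutativeRing R
  open IntegerCoefficientSolver R using (solve; _:=_; _:+_; _:*_; con)
  open import Algebra.Properties.Semiring.Sum semiring using (sum-syntax; sum-cong-≋; ∑-distrib-+; *-distribˡ-sum)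
  open import Data.Nat using (_∸_)
  open import Data.Integer using (+_)
  open import Data.Fin using (Fin; toℕ)
  open import Data.Product using (_×_; _,_; proj₁)
  open Relation.Binary.Reasoning.Setoid setoid

  H : ℕ → Carrier
  H zero          = 1#
  H (suc zero)    = 0#
  H (suc (suc n)) = α * H (suc n) + β * H n

  IsSolution : (ℕ → Carrier) → Set ℓ
  IsSolution u = ∀ n → u (suc (suc n)) ≈ α * u (suc n) + β * u n

  solutions-unique : ∀ {u v} → IsSolution u → IsSolution v → u 0 ≈ v 0 → u 1 ≈ v 1 → ∀ n → u n ≈ v n
  solutions-unique {u} {v} u-rec v-rec u₀≈v₀ u₁≈v₁ n = proj₁ (agree n)
    where
    agree : ∀ n → u n ≈ v n × u (suc n) ≈ v (suc n)
    agree zero    = u₀≈v₀ , u₁≈v₁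
    agree (suc n) with agree n
    ... | uₙ≈vₙ , uₙ₊₁≈vₙ₊₁ =
      uₙ₊₁≈vₙ₊₁ , trans (u-rec n) (trans (+-cong (*-congˡ uₙ₊₁≈vₙ₊₁) (*-congˡ uₙ≈vₙ)) (sym (v-rec n)))

  ∑ℕ : ℕ → (ℕ → Carrier) → Carrier
  ∑ℕ K f = ∑[ i < K ] f (toℕ i)

  antidiagonalSum : (ℕ → ℕ → Carrier) → ℕ → Carrier
  antidiagonalSum f n = ∑ℕ (suc n) (λ j → f j (n ∸ j))

  antidiagonalSum-snoc : ∀ f n → antidiagonalSum f (suc n) ≈ antidiagonalSum (λ j i → f j (suc i)) n + f (suc n) 0
  antidiagonalSum-snoc f zero    = trans (+-congˡ (+-identityʳ _)) (+-congʳ (sym (+-identityʳ _)))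
  antidiagonalSum-snoc f (suc n) = trans (+-congˡ (antidiagonalSum-snoc (λ j → f (suc j)) n)) (sym (+-assoc _ _ _))

  antidiagonalSum-linear : ∀ f g n → antidiagonalSum (λ j i → α * f j i + β * g j i) n ≈
                                     α * antidiagonalSum f n + β * antidiagonalSum g n
  antidiagonalSum-linear f g n =
    trans (∑-distrib-+ (λ j → α * F j) (λ j → β * G j)) (sym (+-cong (*-distribˡ-sum α F) (*-distribˡ-sum β G)))
    where
    F G : Fin (suc n) → Carrier
    F j = f (toℕ j) (n ∸ toℕ j)
    G j = g (toℕ j) (n ∸ toℕ j)

  antidiagonalSum-isSolution : ∀ f → (∀ i → f 0 (suc i) ≈ 0#) → (∀ j → f (suc j) 0 ≈ α * f j 0) →
                               (∀ j i → f (suc j) (suc i) ≈ α * f j (suc i) + β * f j i) →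
                               IsSolution (antidiagonalSum f)
  antidiagonalSum-isSolution f f-0-suc f-suc-0 f-suc-suc n = begin
    f 0 (suc (suc n)) + antidiagonalSum (λ j → f (suc j)) (suc n)
      ≈⟨ +-cong (f-0-suc (suc n)) (antidiagonalSum-snoc (λ j → f (suc j)) n) ⟩
    0# + (antidiagonalSum (λ j i → f (suc j) (suc i)) n + f (suc (suc n)) 0)
      ≈⟨ +-congˡ (+-cong (trans (sum-cong-≋ {suc n} (λ j → f-suc-suc (toℕ j) (n ∸ toℕ j)))
                                (antidiagonalSum-linear (λ j i → f j (suc i)) f n))
                         (f-suc-0 (suc n))) ⟩
    0# + ((α * X + β * antidiagonalSum f n) + α * f (suc n) 0)
      ≈⟨ solve 5 (λ α β X Y Z → con (+ 0) :+ ((α :* X :+ β :* Y) :+ α :* Z) := α :* (X :+ Z) :+ β :* Y)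
                 refl α β X (antidiagonalSum f n) (f (suc n) 0) ⟩
    α * (X + f (suc n) 0) + β * antidiagonalSum f n
      ≈⟨ +-congʳ (*-congˡ (antidiagonalSum-snoc f n)) ⟨
    α * antidiagonalSum f (suc n) + β * antidiagonalSum f n ∎
    where
    X : Carrier
    X = antidiagonalSum (λ j i → f j (suc i)) n

module LeftHandSide {c ℓ : Level} (R : CommutativeRing c ℓ) (s t : CommutativeRing.Carrier R) where
  open CommutativeRing R hiding (zero)
  open IntegerCoefficientSolver R using (solve; _:=_; _:+_; _:*_; :-_; con)
  open Determinant R
  open Leibniz R
  open SecondOrderRecurrence R (- (t * (1# + s))) (- (s * t)) using (H)
  open ListSum semiring using (sumₗ-map-filter)
  open import Algebra.Properties.Ring ring using (-1*x≈-x)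
  open import Algebra.Properties.Semiring.Sum semiring using (sum-syntax)
  open import Algebra.Properties.CommutativeMonoid.Sum *-commutativeMonoid
    using () renaming (sum to ∏; sum-cong-≋ to ∏-cong; ∑-distrib-+ to ∏-distrib-*; sum-replicate-zero to ∏-replicate-1#)
  open import Data.Nat using (_∸_; _<ᵇ_)
  import Data.Nat.Properties as ℕ
  import Algebra.Properties.Semiring.Sum ℕ.+-*-semiring as ℕΣ
  open import Data.Integer using (+_)
  open import Data.Bool using (if_then_else_)
  open import Data.Empty using (⊥-elim)
  open import Data.Fin using (Fin; zero; suc; toℕ; punchIn; _≟_)
  open import Data.Fin.Properties using (all?; ¬∀⟶∃¬)
  open import Data.Product using (∃; ∃₂; _×_; _,_)
  open import Data.Sum using (_⊎_; inj₁; inj₂)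
  open import Data.Vec using (Vec; lookup)
  open import Data.Vec.Functional using (Vector; _∷_; tail; removeAt)
  open import Function using (_∘_)
  open import Relation.Nullary using (¬_; Dec; yes; no)
  open import Relation.Nullary.Decidable using (¬?; _→-dec_; decidable-stable)
  open import Relation.Binary.PropositionalEquality as ≡ using (_≡_; _≢_)
  open Relation.Binary.Reasoning.Setoid setoid

  M : ∀ {n} → Fin n → Fin n → Carrier
  M zero    zero    = 0#
  M zero    (suc j) = s * pow R t (suc (toℕ j))
  M (suc i) zero    = 1#
  M (suc i) (suc j) = M i j

  M-diag : ∀ {n} (i : Fin n) → M i i ≡ 0#
  M-diag zero    = ≡.refl
  M-diag (suc i) = M-diag i

  M-offDiag : ∀ {n} (i j : Fin n) → i ≢ j →
              M i j ≈ pow R s (if toℕ i <ᵇ toℕ j then 1 else 0) * pow R t (if toℕ i <ᵇ toℕ j then toℕ j ∸ toℕ i else 0)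
  M-offDiag zero    zero    i≢j = ⊥-elim (i≢j ≡.refl)
  M-offDiag zero    (suc j) _   = *-congʳ (sym (*-identityʳ s))
  M-offDiag (suc i) zero    _   = sym (*-identityˡ 1#)
  M-offDiag (suc i) (suc j) i≢j = M-offDiag i j (i≢j ∘ ≡.cong suc)

  reducedRow₀ : ∀ {n} → Vector Carrier (suc (suc n))
  reducedRow₀ zero          = - t
  reducedRow₀ (suc zero)    = s * t
  reducedRow₀ (suc (suc _)) = 0#

  M-row₀ : ∀ {n} (x : Fin (suc (suc n))) → M zero x ≈ t * M (suc zero) x + reducedRow₀ x
  M-row₀ zero          = solve 1 (λ t → con (+ 0) := t :* con (+ 1) :+ :- t) refl t
  M-row₀ (suc zero)    = solve 2 (λ s t → s :* (t :* con (+ 1)) := t :* con (+ 0) :+ s :* t) refl s t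
  M-row₀ (suc (suc y)) = solve 3 (λ s t p → s :* (t :* p) := t :* (s :* p) :+ con (+ 0)) refl s t (pow R t (suc (toℕ y)))

  e₀ : ∀ {n} → Vector Carrier (suc n)
  e₀ zero    = 1#
  e₀ (suc _) = 0#

  M-row₁-punchIn₁ : ∀ {n} (y : Fin (suc n)) → M (suc zero) (punchIn (suc zero) y) ≈ 1# * M zero y + e₀ y
  M-row₁-punchIn₁ zero    = solve 0 (con (+ 1) := con (+ 1) :* con (+ 0) :+ con (+ 1)) refl
  M-row₁-punchIn₁ (suc y) = solve 1 (λ x → x := con (+ 1) :* x :+ con (+ 0)) refl (M zero (suc y))

  ∑-zeroEntries : ∀ {n} (a : Carrier) (X : Fin n → Carrier) → ∑[ x < n ] (a * 0# * X x) ≈ 0#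
  ∑-zeroEntries {n} a X = sum-zero {n} (λ x → trans (*-congʳ (zeroʳ a)) (zeroˡ _))

  cofactor₀ : ∀ {n} (c : Carrier) → det (λ y → (c ∷ const 1#) y * sgn zero y) (tail (M {suc n})) ≈ det (const 1#) (M {n})
  cofactor₀ {n} c = trans (det-removeColumn zero (λ y → (c ∷ const 1#) y * sgn zero y) (tail (M {suc n})) (zeroʳ c))
                          (det-cong {A = M {n}} (λ _ → *-identityˡ 1#) (λ _ _ → refl))

  -- Expanding the reduced row 0 at column 1 leaves the cofactor sign −1 as a weight on column 0
  -- of the minor, so the recurrence is proved for an arbitrary weight c on column 0.
  mutual
    det-M≈H : ∀ n → det (const 1#) (M {n}) ≈ H n
    det-M≈H zero    = refl
    det-M≈H (suc n) = begin
      det (const 1#) (M {suc n})       ≈⟨ det-cong {A = M {suc n}} (λ { zero → refl ; (suc _) → refl }) (λ _ _ → refl) ⟩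
      det (1# ∷ const 1#) (M {suc n})  ≈⟨ det-scaledM≈H n 1# ⟩
      1# * H (suc n)                   ≈⟨ *-identityˡ _ ⟩
      H (suc n)                        ∎

    det-scaledM≈H : ∀ n c → det (c ∷ const 1#) (M {suc n}) ≈ c * H (suc n)
    det-scaledM≈H zero    c = solve 1 (λ c → c :* con (+ 0) :* con (+ 1) :+ con (+ 0) := c :* con (+ 0)) refl c
    det-scaledM≈H (suc n) c = begin
      det ψ (A zero ∷ tail A)
        ≈⟨ det-linear ψ (tail A) t M-row₀ ⟩
      t * det ψ (A (suc zero) ∷ tail A) + det ψ (reducedRow₀ ∷ tail A)
        ≈⟨ +-cong (*-congˡ (det-repeatedRow ψ (A (suc zero)) (tail (tail A))))
                  (+-cong (*-congˡ (trans (cofactor₀ {suc n} c) (det-M≈H (suc n))))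
                          (+-cong (*-congˡ (cofactor₁ n c))
                                  (∑-zeroEntries 1# (λ x → det (λ y → ψ y * sgn (suc (suc x)) y) (tail A))))) ⟩
      t * 0# + (c * - t * H (suc n) + (1# * (s * t) * (- c * H (suc n) + - c * H n) + 0#))
        ≈⟨ solve 5 (λ c s t H₁ H₀ →
                      t :* con (+ 0) :+ (c :* :- t :* H₁ :+ (con (+ 1) :* (s :* t) :* (:- c :* H₁ :+ :- c :* H₀) :+ con (+ 0)))
                        := c :* (:- (t :* (con (+ 1) :+ s)) :* H₁ :+ :- (s :* t) :* H₀))
                   refl c s t (H (suc n)) (H n) ⟩
      c * H (suc (suc n)) ∎
      where
      A : Fin (suc (suc n)) → Fin (suc (suc n)) → Carrier
      A = M
      ψ : Vector Carrier (suc (suc n))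
      ψ = c ∷ const 1#

    cofactor₁ : ∀ n c → det (λ y → (c ∷ const 1#) y * sgn (suc zero) y) (tail (M {suc (suc n)})) ≈ - c * H (suc n) + - c * H n
    cofactor₁ n c = begin
      det (λ y → ψ y * sgn (suc zero) y) (tail A)
        ≈⟨ det-removeColumn (suc zero) (λ y → ψ y * sgn (suc zero) y) (tail A) (zeroʳ 1#) ⟩
      det (removeAt (λ y → ψ y * sgn (suc zero) y) (suc zero)) (λ i → removeAt (tail A i) (suc zero))
        ≈⟨ det-cong {A = λ i → removeAt (tail A i) (suc zero)} {A′ = N₀ ∷ tail B}
                    (λ { zero → trans (*-comm c (- 1#)) (-1*x≈-x c) ; (suc _) → *-identityˡ 1# })
                    (λ { zero y → refl ; (suc i) zero → refl ; (suc i) (suc y) → refl }) ⟩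
      det (- c ∷ const 1#) (N₀ ∷ tail B)
        ≈⟨ det-linear (- c ∷ const 1#) (tail B) 1# M-row₁-punchIn₁ ⟩
      1# * det (- c ∷ const 1#) B + det (- c ∷ const 1#) (e₀ ∷ tail B)
        ≈⟨ +-cong (*-congˡ (det-scaledM≈H n (- c)))
                  (+-cong (*-congˡ (trans (cofactor₀ {n} (- c)) (det-M≈H n)))
                          (∑-zeroEntries 1# (λ x → det (λ y → (- c ∷ const 1#) y * sgn (suc x) y) (tail B)))) ⟩
      1# * (- c * H (suc n)) + (- c * 1# * H n + 0#)
        ≈⟨ solve 3 (λ c H₁ H₀ → con (+ 1) :* (:- c :* H₁) :+ (:- c :* con (+ 1) :* H₀ :+ con (+ 0))
                                  := :- c :* H₁ :+ :- c :* H₀)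
                   refl c (H (suc n)) (H n) ⟩
      - c * H (suc n) + - c * H n ∎
      where
      A : Fin (suc (suc n)) → Fin (suc (suc n)) → Carrier
      A = M
      B : Fin (suc n) → Fin (suc n) → Carrier
      B = M
      ψ : Vector Carrier (suc (suc n))
      ψ = c ∷ const 1#
      N₀ : Vector Carrier (suc n)
      N₀ y = A (suc zero) (punchIn (suc zero) y)

  ¬derangement⇒collision⊎fixedPoint : ∀ {n} (σ : Vec (Fin n) n) → ¬ IsDerangement σ →
    (∃₂ λ i j → i ≢ j × lookup σ i ≡ lookup σ j) ⊎ (∃ λ i → lookup σ i ≡ i)
  ¬derangement⇒collision⊎fixedPoint {n} σ ¬der with all? (λ i → ¬? (lookup σ i ≟ i))
  ... | no ¬fixedPointFree =
    let i , ¬¬fixed = ¬∀⟶∃¬ n _ (λ i → ¬? (lookup σ i ≟ i)) ¬fixedPointFree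
    in  inj₂ (i , decidable-stable (lookup σ i ≟ i) ¬¬fixed)
  ... | yes fixedPointFree =
    let i , ¬injectiveAt-i  = ¬∀⟶∃¬ n _ (λ i → all? (injectiveAt? i)) (λ injective → ¬der (injective , fixedPointFree))
        j , ¬injectiveAt-ij = ¬∀⟶∃¬ n _ (injectiveAt? i) ¬injectiveAt-i
    in  inj₁ (i , j , (λ i≡j → ¬injectiveAt-ij (const i≡j)) ,
              decidable-stable (lookup σ i ≟ lookup σ j) (λ σi≢σj → ¬injectiveAt-ij (⊥-elim ∘ σi≢σj)))
    where
    injectiveAt? : ∀ i j → Dec (lookup σ i ≡ lookup σ j → i ≡ j)
    injectiveAt? i j = (lookup σ i ≟ lookup σ j) →-dec (i ≟ j)

  leibnizTerm-nonDerangement : ∀ {n} (σ : Vec (Fin n) n) → ¬ IsDerangement σ → leibnizTerm (const 1#) M σ ≈ 0#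
  leibnizTerm-nonDerangement σ ¬der with ¬derangement⇒collision⊎fixedPoint σ ¬der
  ... | inj₁ (i , j , i≢j , collision) =
    trans (*-congʳ (trans (*-congˡ (signature-collision σ i j i≢j collision)) (zeroʳ _))) (zeroˡ _)
  ... | inj₂ (i , fixed) =
    trans (*-congˡ (∏-zero _ i (reflexive (≡.trans (≡.cong (M i) fixed) (M-diag i))))) (zeroʳ _)

  leibnizTerm-derangement : ∀ {n} (σ : Vec (Fin n) n) → IsDerangement σ →
                            pow R (- 1#) (inv σ) * pow R s (exc σ) * pow R t (depth σ) ≈ leibnizTerm (const 1#) M σ
  leibnizTerm-derangement {n} σ (injective , fixedPointFree) = begin
    pow R (- 1#) (inv σ) * pow R s (exc σ) * pow R t (depth σ)
      ≡⟨ ≡.cong₂ (λ k l → pow R (- 1#) k * pow R s l * pow R t (depth σ))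
                 (inv≡inversions σ) (ℕList.sumₗ-map-tabulate a (λ i → i)) ⟩
    pow R (- 1#) (inversions σ) * pow R s (ℕΣ.sum a) * pow R t (depth σ)
      ≡⟨ ≡.cong (λ l → pow R (- 1#) (inversions σ) * pow R s (ℕΣ.sum a) * pow R t l)
                (ℕList.sumₗ-map-tabulate b (λ i → i)) ⟩
    pow R (- 1#) (inversions σ) * pow R s (ℕΣ.sum a) * pow R t (ℕΣ.sum b)
      ≈⟨ solve 3 (λ x y z → x :* y :* z := con (+ 1) :* x :* (y :* z)) refl _ _ _ ⟩
    1# * pow R (- 1#) (inversions σ) * (pow R s (ℕΣ.sum a) * pow R t (ℕΣ.sum b))
      ≈⟨ *-cong (*-cong (∏-replicate-1# n) (signature-injective σ injective)) entries ⟨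
    leibnizTerm (const 1#) M σ ∎
    where
    a b : Fin n → ℕ
    a i = if toℕ i <ᵇ toℕ (lookup σ i) then 1 else 0
    b i = if toℕ i <ᵇ toℕ (lookup σ i) then toℕ (lookup σ i) ∸ toℕ i else 0
    entries : ∏ (λ i → M i (lookup σ i)) ≈ pow R s (ℕΣ.sum a) * pow R t (ℕΣ.sum b)
    entries = begin
      ∏ (λ i → M i (lookup σ i))
        ≈⟨ ∏-cong (λ i → M-offDiag i (lookup σ i) (fixedPointFree i ∘ ≡.sym)) ⟩
      ∏ (λ i → pow R s (a i) * pow R t (b i))
        ≈⟨ ∏-distrib-* (λ i → pow R s (a i)) (λ i → pow R t (b i)) ⟩
      ∏ (λ i → pow R s (a i)) * ∏ (λ i → pow R t (b i))
        ≈⟨ *-cong (∏-pow s a) (∏-pow t b) ⟩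
      pow R s (ℕΣ.sum a) * pow R t (ℕΣ.sum b) ∎

  lhsCoeff≈det : ∀ n → lhsCoeff R n s t ≈ det (const 1#) (M {n})
  lhsCoeff≈det n = trans (sumₗ-map-filter isDerangement? leibnizTerm-derangement leibnizTerm-nonDerangement (allVecs n n))
                         (sym (det-leibniz (const 1#) (M {n})))

module RightHandSide {c ℓ : Level} (R : CommutativeRing c ℓ) (s t : CommutativeRing.Carrier R) where
  open CommutativeRing R hiding (zero)
  open IntegerCoefficientSolver R using (solve; _:=_; _:+_; _:*_; :-_; con)
  open SecondOrderRecurrence R (- (t * (1# + s))) (- (s * t))
  open ListSum semiring using (sumₗ; sumₗ-concatMap; sumₗ-map-applyUpTo)
  open import Algebra.Properties.Semiring.Sum semiring using (sum-cong-≋; sum-cong-≗; sum-replicate-zero)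
  open import Data.Nat as ℕ using (_∸_; _<_; _≡ᵇ_; z≤n; s≤s)
  import Data.Nat.Properties as ℕ
  open import Data.Nat.Combinatorics using (_C_; k>n⇒nCk≡0; nCk+nC[k+1]≡[n+1]C[k+1])
  open import Data.Integer using (+_)
  open import Data.Fin using (toℕ)
  open import Data.Fin.Properties using (toℕ≤pred[n])
  open import Data.Bool using (false; if_then_else_)
  open import Data.List using (List; map; concatMap; upTo; applyUpTo)
  open import Data.List.Properties using (map-applyUpTo)
  open import Relation.Nullary using (yes; no)
  open import Relation.Binary.PropositionalEquality as ≡ using (_≡_)
  open Relation.Binary.Reasoning.Setoid setoid

  +-≡ᵇ-cancelˡ : ∀ a i d → ((a ℕ.+ i) ≡ᵇ (a ℕ.+ d)) ≡ (i ≡ᵇ d)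
  +-≡ᵇ-cancelˡ zero    i d = ≡.refl
  +-≡ᵇ-cancelˡ (suc a) i d = +-≡ᵇ-cancelˡ a i d

  +-≡ᵇ-> : ∀ {a n} i → n < a → ((a ℕ.+ i) ≡ᵇ n) ≡ false
  +-≡ᵇ-> {suc a} {zero}  i _         = ≡.refl
  +-≡ᵇ-> {suc a} {suc n} i (s≤s n<a) = +-≡ᵇ-> i n<a

  ∑ℕ-snoc : ∀ K f → ∑ℕ (suc K) f ≈ ∑ℕ K f + f K
  ∑ℕ-snoc zero    f = trans (+-identityʳ _) (sym (+-identityˡ _))
  ∑ℕ-snoc (suc K) f = trans (+-congˡ (∑ℕ-snoc K (λ i → f (suc i)))) (sym (+-assoc _ _ _))

  ∑ℕ-indicator : ∀ K d (f : ℕ → Carrier) → (∀ i → K ≤ i → f i ≈ 0#) →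
                 ∑ℕ K (λ i → if i ≡ᵇ d then f i else 0#) ≈ f d
  ∑ℕ-indicator zero    d       f f≈0 = sym (f≈0 d z≤n)
  ∑ℕ-indicator (suc K) zero    f f≈0 = trans (+-congˡ (sum-replicate-zero K)) (+-identityʳ _)
  ∑ℕ-indicator (suc K) (suc d) f f≈0 =
    trans (+-identityˡ _) (∑ℕ-indicator K d (λ i → f (suc i)) (λ i K≤i → f≈0 (suc i) (s≤s K≤i)))

  fromℕ-+ : ∀ m n → fromℕ R (m ℕ.+ n) ≈ fromℕ R m + fromℕ R n
  fromℕ-+ zero    n = sym (+-identityˡ _)
  fromℕ-+ (suc m) n = trans (+-congˡ (fromℕ-+ m n)) (sym (+-assoc _ _ _))

  -- The summand of rhsCoeff with k = j + 1; it contributes to the coefficient of z^(j+i+2).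
  rhsTerm : ℕ → ℕ → Carrier
  rhsTerm j i = pow R (- 1#) (suc j) * fromℕ R (j C i) * pow R s (suc i) * pow R (1# + s) (j ∸ i) * pow R t (suc j)

  rhsTerm-vanishes : ∀ {j i} → j < i → rhsTerm j i ≈ 0#
  rhsTerm-vanishes {j} {i} j<i rewrite k>n⇒nCk≡0 j<i =
    solve 4 (λ p a b c → p :* con (+ 0) :* a :* b :* c := con (+ 0)) refl
      (pow R (- 1#) (suc j)) (pow R s (suc i)) (pow R (1# + s) (j ∸ i)) (pow R t (suc j))

  rhsTerm-suc-0 : ∀ j → rhsTerm (suc j) 0 ≈ - (t * (1# + s)) * rhsTerm j 0
  rhsTerm-suc-0 j = solve 6 (λ p c s t q r →
      :- con (+ 1) :* p :* c :* (s :* con (+ 1)) :* ((con (+ 1) :+ s) :* q) :* (t :* r)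
        := :- (t :* (con (+ 1) :+ s)) :* (p :* c :* (s :* con (+ 1)) :* q :* r)) refl
    (pow R (- 1#) (suc j)) (fromℕ R 1) s t (pow R (1# + s) j) (pow R t (suc j))

  rhsTerm-suc-suc : ∀ j i → rhsTerm (suc j) (suc i) ≈ - (t * (1# + s)) * rhsTerm j (suc i) + - (s * t) * rhsTerm j i
  rhsTerm-suc-suc j i = begin
    rhsTerm (suc j) (suc i)
      ≈⟨ *-congʳ (*-congʳ (*-congʳ (*-congˡ pascal))) ⟩
    - 1# * p * (a + b) * (s * q) * w * (t * r)
      ≈⟨ solve 8 (λ p a b s q w t r → :- con (+ 1) :* p :* (a :+ b) :* (s :* q) :* w :* (t :* r)
                                      := :- con (+ 1) :* p :* b :* (s :* q) :* w :* (t :* r) :+ :- (s :* t) :* (p :* a :* q :* w :* r))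
                 refl p a b s q w t r ⟩
    - 1# * p * b * (s * q) * w * (t * r) + - (s * t) * rhsTerm j i
      ≈⟨ +-congʳ upper ⟩
    - (t * (1# + s)) * rhsTerm j (suc i) + - (s * t) * rhsTerm j i ∎
    where
    p a b q w r : Carrier
    p = pow R (- 1#) (suc j)
    a = fromℕ R (j C i)
    b = fromℕ R (j C suc i)
    q = pow R s (suc i)
    w = pow R (1# + s) (j ∸ i)
    r = pow R t (suc j)
    pascal : fromℕ R (suc j C suc i) ≈ a + b
    pascal = trans (reflexive (≡.cong (fromℕ R) (≡.sym (nCk+nC[k+1]≡[n+1]C[k+1] j i)))) (fromℕ-+ (j C i) (j C suc i))
    upper : - 1# * p * b * (s * q) * w * (t * r) ≈ - (t * (1# + s)) * rhsTerm j (suc i)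
    upper with i ℕ.<? j
    ... | yes i<j rewrite ℕ.+-∸-assoc 1 i<j =
      solve 7 (λ p b s q w t r → :- con (+ 1) :* p :* b :* (s :* q) :* ((con (+ 1) :+ s) :* w) :* (t :* r)
                                 := :- (t :* (con (+ 1) :+ s)) :* (p :* b :* (s :* q) :* w :* r))
        refl p b s q (pow R (1# + s) (j ∸ suc i)) t r
    ... | no  i≮j = begin
      - 1# * p * b * (s * q) * w * (t * r)
        ≡⟨ ≡.cong (λ k → - 1# * p * fromℕ R k * (s * q) * w * (t * r)) (k>n⇒nCk≡0 j<1+i) ⟩
      - 1# * p * 0# * (s * q) * w * (t * r)
        ≈⟨ solve 6 (λ p s q w t r → :- con (+ 1) :* p :* con (+ 0) :* (s :* q) :* w :* (t :* r) := con (+ 0)) refl p s q w t r ⟩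
      0#
        ≈⟨ trans (*-congˡ (rhsTerm-vanishes j<1+i)) (zeroʳ _) ⟨
      - (t * (1# + s)) * rhsTerm j (suc i) ∎
      where
      j<1+i : j < suc i
      j<1+i = s≤s (ℕ.≮⇒≥ i≮j)

  rhsCoeff≈∑ : ∀ n → rhsCoeff R n s t ≈
                     ∑ℕ n (λ k → ∑ℕ (suc k) (λ i → if (suc k ℕ.+ 1 ℕ.+ i) ≡ᵇ n then rhsTerm k i else 0#))
  rhsCoeff≈∑ n = begin
    sumₗ (concatMap g (map suc (upTo n)))
      ≈⟨ sumₗ-concatMap g (map suc (upTo n)) ⟩
    sumₗ (map (λ k → sumₗ (g k)) (map suc (upTo n)))
      ≡⟨ ≡.cong (λ ks → sumₗ (map (λ k → sumₗ (g k)) ks)) (map-applyUpTo (λ k → k) suc n) ⟩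
    sumₗ (map (λ k → sumₗ (g k)) (applyUpTo suc n))
      ≡⟨ sumₗ-map-applyUpTo (λ k → sumₗ (g k)) suc n ⟩
    ∑ℕ n (λ k → sumₗ (g (suc k)))
      ≡⟨ sum-cong-≗ {n} (λ k → sumₗ-map-applyUpTo (summand (suc (toℕ k))) (λ i → i) (suc (toℕ k))) ⟩
    ∑ℕ n (λ k → ∑ℕ (suc k) (summand (suc k))) ∎
    where
    summand : ℕ → ℕ → Carrier
    summand k i = if (k ℕ.+ 1 ℕ.+ i) ≡ᵇ n
      then pow R (- 1#) k * fromℕ R ((k ∸ 1) C i) * pow R s (1 ℕ.+ i) * pow R (1# + s) (k ∸ 1 ∸ i) * pow R t k
      else 0#
    g : ℕ → List Carrier
    g k = map (summand k) (upTo k)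

  rhsCoeff≈antidiagonalSum : ∀ m → rhsCoeff R (suc (suc m)) s t ≈ antidiagonalSum rhsTerm m
  rhsCoeff≈antidiagonalSum m = begin
    rhsCoeff R (suc (suc m)) s t       ≈⟨ rhsCoeff≈∑ (suc (suc m)) ⟩
    ∑ℕ (suc (suc m)) inner             ≈⟨ ∑ℕ-snoc (suc m) inner ⟩
    ∑ℕ (suc m) inner + inner (suc m)   ≈⟨ +-cong (sum-cong-≋ {suc m} (λ k → inner-diagonal (toℕ≤pred[n] k))) inner-last ⟩
    antidiagonalSum rhsTerm m + 0#     ≈⟨ +-identityʳ _ ⟩
    antidiagonalSum rhsTerm m          ∎
    where
    inner : ℕ → Carrier
    inner k = ∑ℕ (suc k) (λ i → if (suc k ℕ.+ 1 ℕ.+ i) ≡ᵇ suc (suc m) then rhsTerm k i else 0#)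
    inner-diagonal : ∀ {k} → k ≤ m → inner k ≈ rhsTerm k (m ∸ k)
    inner-diagonal {k} k≤m = begin
      inner k
        ≡⟨ sum-cong-≗ {suc k} (λ i → ≡.cong (λ b → if b then rhsTerm k (toℕ i) else 0#) (select (toℕ i))) ⟩
      ∑ℕ (suc k) (λ i → if i ≡ᵇ (m ∸ k) then rhsTerm k i else 0#)
        ≈⟨ ∑ℕ-indicator (suc k) (m ∸ k) (rhsTerm k) (λ i k<i → rhsTerm-vanishes k<i) ⟩
      rhsTerm k (m ∸ k) ∎
      where
      k+1+[m∸k]≡1+m : k ℕ.+ 1 ℕ.+ (m ∸ k) ≡ suc m
      k+1+[m∸k]≡1+m = ≡.trans (ℕ.+-assoc k 1 (m ∸ k))
                              (≡.trans (ℕ.+-suc k (m ∸ k)) (≡.cong suc (ℕ.m+[n∸m]≡n k≤m)))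
      select : ∀ i → ((suc k ℕ.+ 1 ℕ.+ i) ≡ᵇ suc (suc m)) ≡ (i ≡ᵇ (m ∸ k))
      select i = ≡.trans (≡.cong (λ n → (suc k ℕ.+ 1 ℕ.+ i) ≡ᵇ suc n) (≡.sym k+1+[m∸k]≡1+m))
                         (+-≡ᵇ-cancelˡ (suc k ℕ.+ 1) i (m ∸ k))
    inner-last : inner (suc m) ≈ 0#
    inner-last = trans (reflexive (sum-cong-≗ {suc (suc m)} (λ i →
                          ≡.cong (λ b → if b then rhsTerm (suc m) (toℕ i) else 0#)
                                 (+-≡ᵇ-> (toℕ i) (ℕ.m<m+n (suc (suc m)) {1} (s≤s z≤n))))))
                       (sum-replicate-zero (suc (suc m)))

  rhsCoeff≈H : ∀ n → rhsCoeff R (suc n) s t ≈ H (suc n)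
  rhsCoeff≈H zero    = +-identityʳ 0#
  rhsCoeff≈H (suc m) = trans (rhsCoeff≈antidiagonalSum m)
                              (solutions-unique {v = λ n → H (suc (suc n))} isSolution (λ _ → refl) H₂ H₃ m)
    where
    isSolution : IsSolution (antidiagonalSum rhsTerm)
    isSolution = antidiagonalSum-isSolution rhsTerm (λ i → rhsTerm-vanishes {0} {suc i} (s≤s z≤n)) rhsTerm-suc-0 rhsTerm-suc-suc
    H₂ : antidiagonalSum rhsTerm 0 ≈ H 2
    H₂ = solve 2 (λ s t → :- con (+ 1) :* con (+ 1) :* (con (+ 1) :+ con (+ 0)) :* (s :* con (+ 1)) :* con (+ 1)
                            :* (t :* con (+ 1)) :+ con (+ 0)
                          := :- (t :* (con (+ 1) :+ s)) :* con (+ 0) :+ :- (s :* t) :* con (+ 1)) refl s t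
    H₃ : antidiagonalSum rhsTerm 1 ≈ H 3
    H₃ = solve 2 (λ s t → :- con (+ 1) :* con (+ 1) :* con (+ 0) :* (s :* (s :* con (+ 1))) :* con (+ 1) :* (t :* con (+ 1))
                          :+ (:- con (+ 1) :* (:- con (+ 1) :* con (+ 1)) :* (con (+ 1) :+ con (+ 0)) :* (s :* con (+ 1))
                                :* ((con (+ 1) :+ s) :* con (+ 1)) :* (t :* (t :* con (+ 1))) :+ con (+ 0))
                          := :- (t :* (con (+ 1) :+ s)) :* (:- (t :* (con (+ 1) :+ s)) :* con (+ 0) :+ :- (s :* t) :* con (+ 1))
                             :+ :- (s :* t) :* con (+ 0)) refl s t

theorem1p4 : {c ℓ : Level} (R : CommutativeRing c ℓ) (n : ℕ) → 1 ≤ n →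
             (s t : CommutativeRing.Carrier R) →
             CommutativeRing._≈_ R (lhsCoeff R n s t) (rhsCoeff R n s t)
theorem1p4 R (suc n) _ s t = begin
  lhsCoeff R (suc n) s t      ≈⟨ lhsCoeff≈det (suc n) ⟩
  det (const 1#) (M {suc n})  ≈⟨ det-M≈H (suc n) ⟩
  H (suc n)                   ≈⟨ rhsCoeff≈H n ⟨
  rhsCoeff R (suc n) s t      ∎
  where
  open CommutativeRing R using (setoid; _+_; _*_; -_; 1#)
  open Relation.Binary.Reasoning.Setoid setoid
  open Determinant R using (det)
  open SecondOrderRecurrence R (- (t * (1# + s))) (- (s * t)) using (H)
  open LeftHandSide R s t using (M; lhsCoeff≈det; det-M≈H)
  open RightHandSide R s t using (rhsCoeff≈H)
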